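{- Let $B$ be a real symmetric $N\times N$ matrix ($N\geq 2$) having two equal rows (and hence two equal corresponding columns), and let $B'$ be the $(N-1)\times(N-1)$ matrix obtained from $B$ by deleting one of the two repeated rows and the corresponding column. Then $\det(B)=0$ and $\det'(B)=2\det(B')$.
   Context: For an $N\times N$ real symmetric matrix $B$ with eigenvalues $\lambda_1,\dots,\lambda_N$, $\det'(B)$ denotes $\sum_{j=1}^N\prod_{i\neq j}\lambda_i$ (the sum of all products of $N-1$ of the eigenvalues); when $B$ is singular this is the product of the eigenvalues other than one copy of $0$. -}

module Defs where

open import Level using (Level)
open import Data.Nat using (ℕ; zero; suc)
open import Data.Fin using (Fin; zero; suc; punchIn)
open import Algebra.Bundles using (CommutativeRing)
open import Relation.Binary.PropositionalEquality using (_≡_)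
open import Relation.Nullary using (Dec; yes; no)
open import Data.Fin using (_≟_)

module _ {c ℓ : Level} (R : CommutativeRing c ℓ) where
  open CommutativeRing R using (Carrier; _≈_; _+_; _*_; -_; 0#; 1#)

  Matrix : ℕ → Set c
  Matrix n = Fin n → Fin n → Carrier

  Σ : (n : ℕ) → (Fin n → Carrier) → Carrier
  Σ zero    f = 0#
  Σ (suc n) f = f zero + Σ n (λ i → f (suc i))

  Π : (n : ℕ) → (Fin n → Carrier) → Carrier
  Π zero    f = 1#
  Π (suc n) f = f zero * Π n (λ i → f (suc i))

  sgn : {n : ℕ} → Fin n → Carrier
  sgn zero    = 1#
  sgn (suc k) = - sgn k

  minor : {n : ℕ} → Fin (suc n) → Fin (suc n) → Matrix (suc n) → Matrix n
  minor i j M a b = M (punchIn i a) (punchIn j b)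

  det : (n : ℕ) → Matrix n → Carrier
  det zero    M = 1#
  det (suc n) M = Σ (suc n) (λ k → sgn k * (M zero k * det n (minor zero k M)))

  Symmetric : {n : ℕ} → Matrix n → Set ℓ
  Symmetric {n} M = ∀ a b → M a b ≈ M b a

  δ : {n : ℕ} → Fin n → Fin n → Carrier
  δ a b with a ≟ b
  ... | yes _ = 1#
  ... | no  _ = 0#

  -- B = Q diag(λ) Qᵀ with Q orthogonal (QᵀQ = I): λ is the list of
  -- eigenvalues (with multiplicity) of the symmetric matrix B
  EigenDecomposition : (n : ℕ) → Matrix n → Matrix n → (Fin n → Carrier) → Set ℓ
  EigenDecomposition n B Q λs =
    (∀ a b → Σ n (λ k → Q k a * Q k b) ≈ δ a b) ×ᴾ
    (∀ a b → B a b ≈ Σ n (λ k → Q a k * (λs k * Q b k)))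
    where
      open import Data.Product using () renaming (_×_ to _×ᴾ_)

  -- det'(B) = Σ_j Π_{i ≠ j} λ_i, for eigenvalues λ of B
  det′ : (n : ℕ) → (Fin (suc n) → Carrier) → Carrier
  det′ n λs = Σ (suc n) (λ j → Π n (λ i → λs (punchIn j i)))

module Submission where

-- det B = 0 since the determinant is alternating. For det′, work over the dual numbers R[ε]:
-- the orthogonal diagonalisation B = Q diag(λ) Qᵀ gives det (B + εI) = Πₐ (λₐ + ε), whose ε-part
-- is det′ λ; expanding row by row, the ε-part of det (B + εI) is Σ_r det (B with row r := e_r),
-- the sum of the principal minors of B. The minors at r ∉ {i, j} keep both copies of the repeated
-- row and vanish, while the two remaining ones agree because B is symmetric.

open import Defs
open import Level using (Level)
open import Data.Nat using (ℕ; suc)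
open import Data.Fin using (Fin; punchIn)
open import Data.Product using (_×_)
open import Relation.Binary.PropositionalEquality using (_≢_)
open import Algebra.Bundles using (CommutativeRing)
open import Algebra.Structures using (IsCommutativeRing)

open import Data.Nat using (zero)
open import Data.Fin using (zero; suc; punchOut; _≟_)
open import Data.Fin.Properties using (punchInᵢ≢i; punchIn-punchOut; punchOut-punchIn; punchOut-cong; punchIn-injective; suc-injective)
open import Data.Vec.Functional using (updateAt)
open import Data.Vec.Functional.Properties using (updateAt-updates; updateAt-minimal; map-updateAt-local)
open import Data.Product using (_,_; proj₁; proj₂)
open import Data.Empty using (⊥-elim)
open import Function using (const; _∘_)
open import Relation.Binary.PropositionalEquality using (_≡_; cong-app)
open import Relation.Nullary using (yes; no; Dec)
import Relation.Binary.PropositionalEquality as ≡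
import Algebra.Properties.Ring as RingProperties
import Algebra.Properties.CommutativeSemigroup as CommutativeSemigroupProperties
import Algebra.Solver.Ring.NaturalCoefficients.Default as NaturalSolver
import Relation.Binary.Reasoning.Setoid as SetoidReasoning

module Matrices {c ℓ : Level} (R : CommutativeRing c ℓ) where
  open CommutativeRing R hiding (zero)
  open RingProperties ring using (-‿involutive; -‿injective; -0#≈0#; +-inverseʳ-unique; -‿distribˡ-*; -‿distribʳ-*; -‿+-comm)
  open CommutativeSemigroupProperties +-commutativeSemigroup using () renaming (interchange to +-interchange; x∙yz≈y∙xz to x+yz≈y+xz)
  open CommutativeSemigroupProperties *-commutativeSemigroup using () renaming (x∙yz≈y∙xz to x*yz≈y*xz; xy∙z≈xz∙y to xy*z≈xz*y)
  open NaturalSolver commutativeSemiring using (solve; _:+_; _:*_; _:=_)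
  open SetoidReasoning setoid

  -- Finite sums and the Kronecker delta

  Σ-cong : ∀ n {f g : Fin n → Carrier} → (∀ i → f i ≈ g i) → Σ R n f ≈ Σ R n g
  Σ-cong zero    f≈g = refl
  Σ-cong (suc n) f≈g = +-cong (f≈g zero) (Σ-cong n (f≈g ∘ suc))

  Σ-distrib-+ : ∀ n (f g : Fin n → Carrier) → Σ R n (λ i → f i + g i) ≈ Σ R n f + Σ R n g
  Σ-distrib-+ zero    f g = sym (+-identityˡ 0#)
  Σ-distrib-+ (suc n) f g = trans (+-congˡ (Σ-distrib-+ n _ _)) (+-interchange (f zero) (g zero) _ _)

  *-distribˡ-Σ : ∀ n x (f : Fin n → Carrier) → x * Σ R n f ≈ Σ R n (λ i → x * f i)
  *-distribˡ-Σ zero    x f = zeroʳ x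
  *-distribˡ-Σ (suc n) x f = trans (distribˡ x _ _) (+-congˡ (*-distribˡ-Σ n x _))

  *-distribʳ-Σ : ∀ n (f : Fin n → Carrier) x → Σ R n f * x ≈ Σ R n (λ i → f i * x)
  *-distribʳ-Σ n f x = trans (*-comm _ _) (trans (*-distribˡ-Σ n x f) (Σ-cong n (λ i → *-comm x (f i))))

  Σ-zero : ∀ n (f : Fin n → Carrier) → (∀ i → f i ≈ 0#) → Σ R n f ≈ 0#
  Σ-zero zero    f f≈0 = refl
  Σ-zero (suc n) f f≈0 = trans (+-cong (f≈0 zero) (Σ-zero n _ (f≈0 ∘ suc))) (+-identityˡ 0#)

  Σ-neg : ∀ n (f : Fin n → Carrier) → Σ R n (λ i → - f i) ≈ - Σ R n f
  Σ-neg zero    f = sym -0#≈0#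
  Σ-neg (suc n) f = trans (+-congˡ (Σ-neg n _)) (-‿+-comm _ _)

  Σ-comm : ∀ n m (f : Fin n → Fin m → Carrier) →
           Σ R n (λ i → Σ R m (f i)) ≈ Σ R m (λ j → Σ R n (λ i → f i j))
  Σ-comm zero    m f = sym (Σ-zero m _ (λ _ → refl))
  Σ-comm (suc n) m f = trans (+-congˡ (Σ-comm n m _)) (sym (Σ-distrib-+ m _ _))

  Σ-punchIn : ∀ n (r : Fin (suc n)) (f : Fin (suc n) → Carrier) →
              Σ R (suc n) f ≈ f r + Σ R n (f ∘ punchIn r)
  Σ-punchIn n       zero    f = refl
  Σ-punchIn (suc n) (suc r) f = trans (+-congˡ (Σ-punchIn n r (f ∘ suc))) (x+yz≈y+xz _ _ _)

  Π-1 : ∀ n → Π R n (λ _ → 1#) ≈ 1#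
  Π-1 zero    = refl
  Π-1 (suc n) = trans (*-congˡ (Π-1 n)) (*-identityˡ 1#)

  δ-refl : ∀ {n} (a : Fin n) → δ R a a ≈ 1#
  δ-refl a with a ≟ a
  ... | yes _  = refl
  ... | no a≢a = ⊥-elim (a≢a ≡.refl)

  δ-≢ : ∀ {n} {a b : Fin n} → a ≢ b → δ R a b ≈ 0#
  δ-≢ {a = a} {b} a≢b with a ≟ b
  ... | yes a≡b = ⊥-elim (a≢b a≡b)
  ... | no _    = refl

  δ-sym : ∀ {n} (a b : Fin n) → δ R a b ≈ δ R b a
  δ-sym a b with a ≟ b | b ≟ a
  ... | yes _   | yes _   = refl
  ... | no _    | no _    = refl
  ... | yes a≡b | no b≢a  = ⊥-elim (b≢a (≡.sym a≡b))
  ... | no a≢b  | yes b≡a = ⊥-elim (a≢b (≡.sym b≡a))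

  δ-suc : ∀ {n} (a b : Fin n) → δ R (suc a) (suc b) ≈ δ R a b
  δ-suc a b = by-cases (a ≟ b)
    where
    by-cases : Dec (a ≡ b) → δ R (suc a) (suc b) ≈ δ R a b
    by-cases (yes ≡.refl) = trans (δ-refl (suc a)) (sym (δ-refl a))
    by-cases (no a≢b)     = trans (δ-≢ (a≢b ∘ suc-injective)) (sym (δ-≢ a≢b))

  Σ-δ : ∀ n (a : Fin n) (f : Fin n → Carrier) → Σ R n (λ k → δ R a k * f k) ≈ f a
  Σ-δ (suc n) a f = begin
    Σ R (suc n) (λ k → δ R a k * f k)                                  ≈⟨ Σ-punchIn n a (λ k → δ R a k * f k) ⟩
    δ R a a * f a + Σ R n (λ l → δ R a (punchIn a l) * f (punchIn a l)) ≈⟨ +-cong (*-congʳ (δ-refl a)) (Σ-zero n _ off-diagonal) ⟩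
    1# * f a + 0#                                                       ≈⟨ trans (+-identityʳ _) (*-identityˡ _) ⟩
    f a                                                                 ∎
    where
    off-diagonal : ∀ l → δ R a (punchIn a l) * f (punchIn a l) ≈ 0#
    off-diagonal l = trans (*-congʳ (δ-≢ (punchInᵢ≢i a l ∘ ≡.sym))) (zeroˡ _)

  Σ-δʳ : ∀ n (a : Fin n) (f : Fin n → Carrier) → Σ R n (λ k → f k * δ R k a) ≈ f a
  Σ-δʳ n a f = trans (Σ-cong n (λ k → trans (*-comm _ _) (*-congʳ (δ-sym k a)))) (Σ-δ n a f)

  -x*-y≈x*y : ∀ x y → (- x) * (- y) ≈ x * y
  -x*-y≈x*y x y = trans (sym (-‿distribˡ-* x (- y))) (trans (-‿cong (sym (-‿distribʳ-* x y))) (-‿involutive _))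

  sgn*sgn≈1 : ∀ {n} (r : Fin n) → sgn R r * sgn R r ≈ 1#
  sgn*sgn≈1 zero    = *-identityˡ 1#
  sgn*sgn≈1 (suc r) = trans (-x*-y≈x*y _ _) (sgn*sgn≈1 r)

  -- Linearity in a row

  laplaceTerm : ∀ {n} → Matrix R (suc n) → Fin (suc n) → Carrier
  laplaceTerm {n} M k = sgn R k * (M zero k * det R n (minor R zero k M))

  det-cong : ∀ n {M N : Matrix R n} → (∀ a b → M a b ≈ N a b) → det R n M ≈ det R n N
  det-cong zero    M≈N = refl
  det-cong (suc n) M≈N = Σ-cong (suc n) λ k →
    *-congˡ {sgn R k} (*-cong (M≈N zero k) (det-cong n (λ a b → M≈N (suc a) (punchIn k b))))

  setRow : ∀ {n} → Matrix R n → Fin n → (Fin n → Carrier) → Matrix R n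
  setRow M r v = updateAt M r (const v)

  setRow-updates : ∀ {n} (M : Matrix R n) r v → setRow M r v r ≡ v
  setRow-updates M r v = updateAt-updates r M

  setRow-minimal : ∀ {n} (M : Matrix R n) r v {a} → a ≢ r → setRow M r v a ≡ M a
  setRow-minimal M r v {a} a≢r = updateAt-minimal a r M a≢r

  AgreeOffRow : ∀ {n} → Fin n → Matrix R n → Matrix R n → Set ℓ
  AgreeOffRow r M N = ∀ a → a ≢ r → ∀ b → M a b ≈ N a b

  setRow-offRow : ∀ {n} (M : Matrix R n) r v → AgreeOffRow r M (setRow M r v)
  setRow-offRow M r v a a≢r b = reflexive (≡.sym (cong-app (setRow-minimal M r v a≢r) b))

  setRow-row : ∀ {n} (M : Matrix R n) r v b → setRow M r v r b ≈ v b
  setRow-row M r v b = reflexive (cong-app (setRow-updates M r v) b)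

  det-linear-row : ∀ n (r : Fin n) (M N Q : Matrix R n) → AgreeOffRow r M N → AgreeOffRow r M Q →
    (∀ b → M r b ≈ N r b + Q r b) → det R n M ≈ det R n N + det R n Q
  det-linear-row (suc n) r M N Q M≈N M≈Q Mr≈Nr+Qr =
    trans (Σ-cong (suc n) (term r M≈N M≈Q Mr≈Nr+Qr)) (Σ-distrib-+ (suc n) (laplaceTerm N) (laplaceTerm Q))
    where
    term : ∀ r → AgreeOffRow r M N → AgreeOffRow r M Q → (∀ b → M r b ≈ N r b + Q r b) →
           ∀ k → laplaceTerm M k ≈ laplaceTerm N k + laplaceTerm Q k
    term zero M≈N M≈Q Mr≈Nr+Qr k = trans (*-congˡ (*-congʳ (Mr≈Nr+Qr k)))
      (trans (*-congˡ (distribʳ _ _ _)) (trans (distribˡ _ _ _)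
        (+-cong (*-congˡ (*-congˡ (det-cong n (λ a b → M≈N (suc a) (λ ()) _))))
                (*-congˡ (*-congˡ (det-cong n (λ a b → M≈Q (suc a) (λ ()) _)))))))
    term (suc r) M≈N M≈Q Mr≈Nr+Qr k = trans (*-congˡ (*-congˡ
        (det-linear-row n r (minor R zero k M) (minor R zero k N) (minor R zero k Q)
          (λ a a≢r b → M≈N (suc a) (a≢r ∘ suc-injective) _)
          (λ a a≢r b → M≈Q (suc a) (a≢r ∘ suc-injective) _)
          (λ b → Mr≈Nr+Qr _))))
      (trans (*-congˡ (distribˡ _ _ _)) (trans (distribˡ _ _ _)
        (+-cong (*-congˡ (*-congʳ (M≈N zero (λ ()) k))) (*-congˡ (*-congʳ (M≈Q zero (λ ()) k))))))

  det-scale-row : ∀ n (r : Fin n) x (M N : Matrix R n) → AgreeOffRow r M N →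
    (∀ b → M r b ≈ x * N r b) → det R n M ≈ x * det R n N
  det-scale-row (suc n) r x M N M≈N Mr≈xNr =
    trans (Σ-cong (suc n) (term r M≈N Mr≈xNr)) (sym (*-distribˡ-Σ (suc n) x (laplaceTerm N)))
    where
    term : ∀ r → AgreeOffRow r M N → (∀ b → M r b ≈ x * N r b) → ∀ k → laplaceTerm M k ≈ x * laplaceTerm N k
    term zero M≈N Mr≈xNr k = trans (*-congˡ (*-cong (Mr≈xNr k) (det-cong n (λ a b → M≈N (suc a) (λ ()) _))))
      (trans (*-congˡ (*-assoc _ _ _)) (x*yz≈y*xz _ _ _))
    term (suc r) M≈N Mr≈xNr k = trans (*-congˡ (*-cong (M≈N zero (λ ()) k)
        (det-scale-row n r x (minor R zero k M) (minor R zero k N) (λ a a≢r b → M≈N (suc a) (a≢r ∘ suc-injective) _) (λ b → Mr≈xNr _))))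
      (trans (*-congˡ (x*yz≈y*xz _ _ _)) (x*yz≈y*xz _ _ _))

  -- Alternation

  punchIn-punchOut-swap : ∀ {n} (k m : Fin (suc (suc n))) (k≢m : k ≢ m) (m≢k : m ≢ k) (b : Fin n) →
    punchIn k (punchIn (punchOut k≢m) b) ≡ punchIn m (punchIn (punchOut m≢k) b)
  punchIn-punchOut-swap zero    zero    k≢m m≢k b = ⊥-elim (k≢m ≡.refl)
  punchIn-punchOut-swap zero    (suc m) k≢m m≢k b = ≡.refl
  punchIn-punchOut-swap (suc k) zero    k≢m m≢k b = ≡.refl
  punchIn-punchOut-swap {suc n} (suc k) (suc m) k≢m m≢k zero    = ≡.refl
  punchIn-punchOut-swap {suc n} (suc k) (suc m) k≢m m≢k (suc b) =
    ≡.cong suc (punchIn-punchOut-swap k m (k≢m ∘ ≡.cong suc) (m≢k ∘ ≡.cong suc) b)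

  sgn-punchOut-swap : ∀ {n} (k m : Fin (suc (suc n))) (k≢m : k ≢ m) (m≢k : m ≢ k) →
    sgn R k * sgn R (punchOut k≢m) ≈ - (sgn R m * sgn R (punchOut m≢k))
  sgn-punchOut-swap zero    zero    k≢m m≢k = ⊥-elim (k≢m ≡.refl)
  sgn-punchOut-swap zero    (suc m) k≢m m≢k = trans (*-identityˡ _) (trans (sym (-‿involutive _)) (-‿cong (sym (*-identityʳ _))))
  sgn-punchOut-swap (suc k) zero    k≢m m≢k = trans (*-identityʳ _) (-‿cong (sym (*-identityˡ _)))
  sgn-punchOut-swap {zero}  (suc zero) (suc zero) k≢m m≢k = ⊥-elim (k≢m ≡.refl)
  sgn-punchOut-swap {suc n} (suc k) (suc m) k≢m m≢k = trans (-x*-y≈x*y _ _)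
    (trans (sgn-punchOut-swap k m (k≢m ∘ ≡.cong suc) (m≢k ∘ ≡.cong suc)) (-‿cong (sym (-x*-y≈x*y _ _))))

  -- The term of the Laplace expansion along rows 0 and 1 in which row 0 uses column k and row 1 column m.
  pairTerm : ∀ {n} → Matrix R (suc (suc n)) → Fin (suc (suc n)) → Fin (suc (suc n)) → Carrier
  pairTerm M k m with k ≟ m
  ... | yes _   = 0#
  ... | no k≢m  = sgn R k * (M zero k * laplaceTerm (minor R zero k M) (punchOut k≢m))

  pairTerm-diag : ∀ {n} (M : Matrix R (suc (suc n))) k → pairTerm M k k ≈ 0#
  pairTerm-diag M k with k ≟ k
  ... | yes _  = refl
  ... | no k≢k = ⊥-elim (k≢k ≡.refl)

  pairTerm-punchIn : ∀ {n} (M : Matrix R (suc (suc n))) k l →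
    pairTerm M k (punchIn k l) ≈ sgn R k * (M zero k * laplaceTerm (minor R zero k M) l)
  pairTerm-punchIn M k l with k ≟ punchIn k l
  ... | yes k≡ = ⊥-elim (punchInᵢ≢i k l (≡.sym k≡))
  ... | no k≢  = reflexive (≡.cong (λ l′ → sgn R k * (M zero k * laplaceTerm (minor R zero k M) l′))
                                   (≡.trans (punchOut-cong k ≡.refl) (punchOut-punchIn k)))

  det≈ΣΣpairTerm : ∀ n (M : Matrix R (suc (suc n))) →
    det R (suc (suc n)) M ≈ Σ R (suc (suc n)) (λ k → Σ R (suc (suc n)) (pairTerm M k))
  det≈ΣΣpairTerm n M = Σ-cong (suc (suc n)) λ k → begin
    sgn R k * (M zero k * Σ R (suc n) (laplaceTerm (minor R zero k M)))
      ≈⟨ trans (*-congˡ (*-distribˡ-Σ (suc n) (M zero k) (laplaceTerm (minor R zero k M))))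
               (*-distribˡ-Σ (suc n) (sgn R k) (λ l → M zero k * laplaceTerm (minor R zero k M) l)) ⟩
    Σ R (suc n) (λ l → sgn R k * (M zero k * laplaceTerm (minor R zero k M) l))
      ≈⟨ trans (Σ-cong (suc n) (λ l → sym (pairTerm-punchIn M k l))) (sym (+-identityˡ _)) ⟩
    0# + Σ R (suc n) (pairTerm M k ∘ punchIn k)
      ≈⟨ sym (trans (Σ-punchIn (suc n) k (pairTerm M k)) (+-congʳ (pairTerm-diag M k))) ⟩
    Σ R (suc (suc n)) (pairTerm M k) ∎

  -- The hypotheses cover both M′ = M with rows 0 and 1 equal, and M′ = M with rows 0 and 1 swapped.
  pairTerm-antisym : ∀ {n} (M M′ : Matrix R (suc (suc n))) →
    (∀ a b → M′ (suc (suc a)) b ≈ M (suc (suc a)) b) →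
    (∀ k m → M′ zero k * M′ (suc zero) m ≈ M zero m * M (suc zero) k) →
    ∀ k m → pairTerm M′ k m ≈ - pairTerm M m k
  pairTerm-antisym {n} M M′ lower≈ top≈ k m with k ≟ m | m ≟ k
  ... | yes _   | yes _   = sym -0#≈0#
  ... | yes k≡m | no m≢k  = ⊥-elim (m≢k (≡.sym k≡m))
  ... | no k≢m  | yes m≡k = ⊥-elim (k≢m (≡.sym m≡k))
  ... | no k≢m  | no m≢k  = begin
    sgn R k * (M′ zero k * (sgn R k′ * (M′ (suc zero) (punchIn k k′) * det R n (minor R zero k′ (minor R zero k M′)))))
      ≈⟨ regroup _ _ _ _ _ ⟩
    (sgn R k * sgn R k′) * ((M′ zero k * M′ (suc zero) (punchIn k k′)) * det R n (minor R zero k′ (minor R zero k M′)))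
      ≈⟨ *-cong (sgn-punchOut-swap k m k≢m m≢k)
                (*-cong (trans (*-congˡ (reflexive (≡.cong (M′ (suc zero)) (punchIn-punchOut k≢m)))) (top≈ k m))
                        (det-cong n (λ a b → trans (reflexive (≡.cong (M′ (suc (suc a))) (punchIn-punchOut-swap k m k≢m m≢k b)))
                                                   (lower≈ a _)))) ⟩
    (- (sgn R m * sgn R m′)) * ((M zero m * M (suc zero) k) * det R n (minor R zero m′ (minor R zero m M)))
      ≈⟨ sym (-‿distribˡ-* _ _) ⟩
    - ((sgn R m * sgn R m′) * ((M zero m * M (suc zero) k) * det R n (minor R zero m′ (minor R zero m M))))
      ≈⟨ -‿cong (*-congˡ (*-congʳ (*-congˡ (reflexive (≡.cong (M (suc zero)) (≡.sym (punchIn-punchOut m≢k))))))) ⟩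
    - ((sgn R m * sgn R m′) * ((M zero m * M (suc zero) (punchIn m m′)) * det R n (minor R zero m′ (minor R zero m M))))
      ≈⟨ -‿cong (sym (regroup _ _ _ _ _)) ⟩
    - (sgn R m * (M zero m * (sgn R m′ * (M (suc zero) (punchIn m m′) * det R n (minor R zero m′ (minor R zero m M)))))) ∎
    where
    k′ = punchOut k≢m
    m′ = punchOut m≢k
    regroup : ∀ s x t y d → s * (x * (t * (y * d))) ≈ (s * t) * ((x * y) * d)
    regroup = solve 5 (λ s x t y d → s :* (x :* (t :* (y :* d))) := (s :* t) :* ((x :* y) :* d)) refl

  ΣΣ-antisym≈0 : ∀ n (V : Fin n → Fin n → Carrier) → (∀ k → V k k ≈ 0#) → (∀ k m → V k m ≈ - V m k) →
    Σ R n (λ k → Σ R n (V k)) ≈ 0#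
  ΣΣ-antisym≈0 zero    V diag≈0 antisym = refl
  ΣΣ-antisym≈0 (suc n) V diag≈0 antisym = begin
    (V zero zero + Σ R n (V zero ∘ suc)) + Σ R n (λ k → V (suc k) zero + Σ R n (V (suc k) ∘ suc))
      ≈⟨ +-cong (+-congʳ (diag≈0 zero)) (Σ-distrib-+ n (λ k → V (suc k) zero) (λ k → Σ R n (V (suc k) ∘ suc))) ⟩
    (0# + Σ R n (V zero ∘ suc)) + (Σ R n (λ k → V (suc k) zero) + Σ R n (λ k → Σ R n (V (suc k) ∘ suc)))
      ≈⟨ +-cong (+-identityˡ _) (+-cong (trans (Σ-cong n (λ k → antisym (suc k) zero)) (Σ-neg n _))
                                        (ΣΣ-antisym≈0 n (λ k m → V (suc k) (suc m)) (diag≈0 ∘ suc) (λ k m → antisym (suc k) (suc m)))) ⟩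
    Σ R n (V zero ∘ suc) + (- Σ R n (V zero ∘ suc) + 0#)
      ≈⟨ trans (+-congˡ (+-identityʳ _)) (-‿inverseʳ _) ⟩
    0# ∎

  det-equalRows01 : ∀ n (M : Matrix R (suc (suc n))) → (∀ b → M zero b ≈ M (suc zero) b) → det R (suc (suc n)) M ≈ 0#
  det-equalRows01 n M row0≈row1 = trans (det≈ΣΣpairTerm n M)
    (ΣΣ-antisym≈0 (suc (suc n)) (pairTerm M) (pairTerm-diag M)
      (pairTerm-antisym M M (λ a b → refl) (λ k m → trans (*-cong (row0≈row1 k) (sym (row0≈row1 m))) (*-comm _ _))))

  swap01 : ∀ {n} → Fin (suc (suc n)) → Fin (suc (suc n))
  swap01 zero          = suc zero
  swap01 (suc zero)    = zero
  swap01 (suc (suc a)) = suc (suc a)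

  det-swap01 : ∀ n (M : Matrix R (suc (suc n))) → det R (suc (suc n)) (M ∘ swap01) ≈ - det R (suc (suc n)) M
  det-swap01 n M = begin
    det R N (M ∘ swap01)                                 ≈⟨ det≈ΣΣpairTerm n (M ∘ swap01) ⟩
    Σ R N (λ k → Σ R N (pairTerm (M ∘ swap01) k))
      ≈⟨ Σ-cong N (λ k → Σ-cong N (pairTerm-antisym M (M ∘ swap01) (λ a b → refl) (λ k m → *-comm _ _) k)) ⟩
    Σ R N (λ k → Σ R N (λ m → - pairTerm M m k))
      ≈⟨ trans (Σ-cong N (λ k → Σ-neg N (λ m → pairTerm M m k))) (Σ-neg N (λ k → Σ R N (λ m → pairTerm M m k))) ⟩
    - Σ R N (λ k → Σ R N (λ m → pairTerm M m k))         ≈⟨ -‿cong (Σ-comm N N (λ k m → pairTerm M m k)) ⟩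
    - Σ R N (λ m → Σ R N (pairTerm M m))                 ≈⟨ -‿cong (sym (det≈ΣΣpairTerm n M)) ⟩
    - det R N M                                          ∎
    where
    N = suc (suc n)

  -x≈0⇒x≈0 : ∀ {x} → - x ≈ 0# → x ≈ 0#
  -x≈0⇒x≈0 -x≈0 = -‿injective (trans -x≈0 (sym -0#≈0#))

  x≈-y⇒y≈-x : ∀ {x y} → x ≈ - y → y ≈ - x
  x≈-y⇒y≈-x x≈-y = trans (sym (-‿involutive _)) (-‿cong (sym x≈-y))

  laplaceTerm-zero : ∀ {n} (M : Matrix R (suc n)) k → det R n (minor R zero k M) ≈ 0# → laplaceTerm M k ≈ 0#
  laplaceTerm-zero M k d≈0 = trans (*-congˡ (trans (*-congˡ d≈0) (zeroʳ _))) (zeroʳ _)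

  det-equalRow0 : ∀ n (j : Fin (suc n)) (M : Matrix R (suc (suc n))) → (∀ b → M zero b ≈ M (suc j) b) →
    det R (suc (suc n)) M ≈ 0#
  det-equalRow0 n       zero    M row0≈rowj = det-equalRows01 n M row0≈rowj
  -- After swapping rows 0 and 1, every minor along row 0 still contains rows 0 and suc j of M.
  det-equalRow0 (suc n) (suc j) M row0≈rowj = -x≈0⇒x≈0 (trans (sym (det-swap01 (suc n) M))
    (Σ-zero (suc (suc (suc n))) _ λ k → laplaceTerm-zero (M ∘ swap01) k
      (det-equalRow0 n j (minor R zero k (M ∘ swap01)) (λ b → row0≈rowj (punchIn k b)))))

  det-equalRows : ∀ n (i j : Fin n) (M : Matrix R n) → i ≢ j → (∀ b → M i b ≈ M j b) → det R n M ≈ 0#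
  det-equalRows (suc n)       zero    zero    M i≢j rowi≈rowj = ⊥-elim (i≢j ≡.refl)
  det-equalRows (suc (suc n)) zero    (suc j) M i≢j rowi≈rowj = det-equalRow0 n j M rowi≈rowj
  det-equalRows (suc (suc n)) (suc i) zero    M i≢j rowi≈rowj = det-equalRow0 n i M (sym ∘ rowi≈rowj)
  det-equalRows (suc n)       (suc i) (suc j) M i≢j rowi≈rowj = Σ-zero (suc n) _ λ k → laplaceTerm-zero M k
    (det-equalRows n i j (minor R zero k M) (i≢j ∘ ≡.cong suc) (λ b → rowi≈rowj (punchIn k b)))

  toFront : ∀ {n} → Fin (suc n) → Fin (suc n) → Fin (suc n)
  toFront r zero    = r
  toFront r (suc a) = punchIn r a

  toFront-zero : ∀ {n} (a : Fin (suc n)) → toFront zero a ≡ a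
  toFront-zero zero    = ≡.refl
  toFront-zero (suc a) = ≡.refl

  det-toFront : ∀ n (r : Fin (suc n)) (M : Matrix R (suc n)) → det R (suc n) (M ∘ toFront r) ≈ sgn R r * det R (suc n) M
  det-toFront n       zero    M = trans (det-cong (suc n) (λ a b → reflexive (≡.cong (λ a′ → M a′ b) (toFront-zero a))))
                                        (sym (*-identityˡ _))
  det-toFront (suc n) (suc r) M = begin
    det R N (M ∘ toFront (suc r))                ≈⟨ x≈-y⇒y≈-x (det-swap01 n (M ∘ toFront (suc r))) ⟩
    - det R N (M ∘ toFront (suc r) ∘ swap01)
      ≈⟨ -‿cong (Σ-cong N λ k → *-congˡ {sgn R k} (*-congˡ {M zero k}
           (trans (det-cong (suc n) (λ a b → reflexive (minor-toFront k a b))) (det-toFront n r (minor R zero k M))))) ⟩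
    - Σ R N (λ k → sgn R k * (M zero k * (sgn R r * det R (suc n) (minor R zero k M))))
      ≈⟨ -‿cong (trans (Σ-cong N (λ k → trans (*-congˡ (x*yz≈y*xz (M zero k) (sgn R r) (det R (suc n) (minor R zero k M))))
                                              (x*yz≈y*xz (sgn R k) (sgn R r) _)))
                       (sym (*-distribˡ-Σ N (sgn R r) (laplaceTerm M)))) ⟩
    - (sgn R r * det R N M)                      ≈⟨ -‿distribˡ-* _ _ ⟩
    sgn R (suc r) * det R N M                    ∎
    where
    N = suc (suc n)
    minor-toFront : ∀ k a b → minor R zero k (M ∘ toFront (suc r) ∘ swap01) a b ≡ (minor R zero k M ∘ toFront r) a b
    minor-toFront k zero    b = ≡.refl
    minor-toFront k (suc a) b = ≡.refl

  transpose : ∀ {n} → Matrix R n → Matrix R n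
  transpose M a b = M b a

  det-transpose : ∀ n (M : Matrix R n) → det R n (transpose M) ≈ det R n M
  det-transpose zero          M = refl
  det-transpose (suc zero)    M = refl
  det-transpose (suc (suc n)) M = begin
    det R N (transpose M)
      ≈⟨ Σ-cong N (λ k → *-congˡ {sgn R k} (*-congˡ {M k zero} (det-transpose (suc n) (minor R k zero M)))) ⟩
    X₀₀ + Σ R (suc n) (λ k → sgn R (suc k) * (M (suc k) zero * Σ R (suc n) (λ l → sgn R l * (M zero (suc l) * E k l))))
      ≈⟨ +-congˡ (Σ-cong (suc n) (λ k → *-distribˡ-Σ² (sgn R (suc k)) (M (suc k) zero) (λ l → sgn R l * (M zero (suc l) * E k l)))) ⟩
    X₀₀ + Σ R (suc n) (λ k → Σ R (suc n) (λ l → sgn R (suc k) * (M (suc k) zero * (sgn R l * (M zero (suc l) * E k l)))))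
      ≈⟨ +-congˡ (Σ-comm (suc n) (suc n) (λ k l → sgn R (suc k) * (M (suc k) zero * (sgn R l * (M zero (suc l) * E k l))))) ⟩
    X₀₀ + Σ R (suc n) (λ l → Σ R (suc n) (λ k → sgn R (suc k) * (M (suc k) zero * (sgn R l * (M zero (suc l) * E k l)))))
      ≈⟨ +-congˡ (Σ-cong (suc n) (λ l → Σ-cong (suc n) (λ k → swap-factors (sgn R k) (sgn R l) (M (suc k) zero) (M zero (suc l)) (E k l)))) ⟩
    X₀₀ + Σ R (suc n) (λ l → Σ R (suc n) (λ k → sgn R (suc l) * (M zero (suc l) * (sgn R k * (M (suc k) zero * E k l)))))
      ≈⟨ +-congˡ (Σ-cong (suc n) (λ l → sym (*-distribˡ-Σ² (sgn R (suc l)) (M zero (suc l)) (λ k → sgn R k * (M (suc k) zero * E k l))))) ⟩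
    X₀₀ + Σ R (suc n) (λ l → sgn R (suc l) * (M zero (suc l) * Σ R (suc n) (λ k → sgn R k * (M (suc k) zero * E k l))))
      ≈⟨ +-congˡ (Σ-cong (suc n) (λ l → *-congˡ {sgn R (suc l)} (*-congˡ {M zero (suc l)}
           (trans (Σ-cong (suc n) (λ k → *-congˡ {sgn R k} (*-congˡ {M (suc k) zero}
                    (sym (det-transpose n (λ a b → M (suc (punchIn k a)) (suc (punchIn l b))))))))
                  (det-transpose (suc n) (minor R zero (suc l) M)))))) ⟩
    det R N M ∎
    where
    N = suc (suc n)
    X₀₀ : Carrier
    X₀₀ = sgn R {N} zero * (M zero zero * det R (suc n) (minor R zero zero M))
    E : Fin (suc n) → Fin (suc n) → Carrier
    E k l = det R n (λ a b → M (suc (punchIn k a)) (suc (punchIn l b)))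
    *-distribˡ-Σ² : ∀ s x (f : Fin (suc n) → Carrier) → s * (x * Σ R (suc n) f) ≈ Σ R (suc n) (λ i → s * (x * f i))
    *-distribˡ-Σ² s x f = trans (*-congˡ (*-distribˡ-Σ (suc n) x f)) (*-distribˡ-Σ (suc n) s (λ i → x * f i))
    swap-factors : ∀ s t x y e → (- s) * (x * (t * (y * e))) ≈ (- t) * (y * (s * (x * e)))
    swap-factors s t x y e = trans (sym (-‿distribˡ-* _ _)) (trans (-‿cong (exchange s t x y e)) (-‿distribˡ-* _ _))
      where
      exchange : ∀ s t x y e → s * (x * (t * (y * e))) ≈ t * (y * (s * (x * e)))
      exchange = solve 5 (λ s t x y e → s :* (x :* (t :* (y :* e))) := t :* (y :* (s :* (x :* e)))) refl

  det-swapRows : ∀ n (i j : Fin n) (M N : Matrix R n) → i ≢ j →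
    (∀ a → a ≢ i → a ≢ j → ∀ b → M a b ≈ N a b) → (∀ b → M i b ≈ N j b) → (∀ b → M j b ≈ N i b) →
    det R n M ≈ - det R n N
  det-swapRows n i j M N i≢j others≈ Mi≈Nj Mj≈Ni = +-inverseʳ-unique (det R n N) (det R n M) (begin
    det R n N + det R n M                 ≈⟨ +-comm _ _ ⟩
    det R n M + det R n N                 ≈⟨ sym (+-cong (+-identityˡ _) (+-identityʳ _)) ⟩
    (0# + det R n M) + (det R n N + 0#)   ≈⟨ sym (+-cong (+-cong (D-diag (M i)) (det-cong n E-M)) (+-cong (det-cong n E-N) (D-diag (M j)))) ⟩
    (D (M i) (M i) + D (M i) (M j)) + (D (M j) (M i) + D (M j) (M j)) ≈⟨ sym (+-cong (D-+ʳ (M i)) (D-+ʳ (M j))) ⟩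
    D (M i) (M i ⊕ M j) + D (M j) (M i ⊕ M j)                       ≈⟨ sym D-+ˡ ⟩
    D (M i ⊕ M j) (M i ⊕ M j)             ≈⟨ D-diag _ ⟩
    0#                                    ∎)
    where
    _⊕_ : (Fin n → Carrier) → (Fin n → Carrier) → Fin n → Carrier
    (u ⊕ w) b = u b + w b
    E : (Fin n → Carrier) → (Fin n → Carrier) → Matrix R n
    E u w = setRow (setRow M i u) j w
    D : (Fin n → Carrier) → (Fin n → Carrier) → Carrier
    D u w = det R n (E u w)
    E-i : ∀ u w → E u w i ≡ u
    E-i u w = ≡.trans (setRow-minimal _ j w i≢j) (setRow-updates M i u)
    E-j : ∀ u w → E u w j ≡ w
    E-j u w = setRow-updates _ j w
    E-other : ∀ u w {a} → a ≢ i → a ≢ j → E u w a ≡ M a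
    E-other u w a≢i a≢j = ≡.trans (setRow-minimal _ j w a≢j) (setRow-minimal M i u a≢i)
    E-offRow-i : ∀ u u′ w → AgreeOffRow i (E u w) (E u′ w)
    E-offRow-i u u′ w a a≢i b with a ≟ j
    ... | yes ≡.refl = reflexive (cong-app (≡.trans (E-j u w) (≡.sym (E-j u′ w))) b)
    ... | no a≢j     = reflexive (cong-app (≡.trans (E-other u w a≢i a≢j) (≡.sym (E-other u′ w a≢i a≢j))) b)
    E-offRow-j : ∀ u w w′ → AgreeOffRow j (E u w) (E u w′)
    E-offRow-j u w w′ a a≢j b = reflexive (cong-app (≡.trans (setRow-minimal _ j w a≢j) (≡.sym (setRow-minimal _ j w′ a≢j))) b)
    D-diag : ∀ u → D u u ≈ 0#
    D-diag u = det-equalRows n i j (E u u) i≢j (λ b → reflexive (cong-app (≡.trans (E-i u u) (≡.sym (E-j u u))) b))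
    D-+ˡ : D (M i ⊕ M j) (M i ⊕ M j) ≈ D (M i) (M i ⊕ M j) + D (M j) (M i ⊕ M j)
    D-+ˡ = det-linear-row n i _ _ _ (E-offRow-i _ _ _) (E-offRow-i _ _ _)
      (λ b → reflexive (cong-app (≡.trans (E-i _ _) (≡.sym (≡.cong₂ (_⊕_) (E-i (M i) _) (E-i (M j) _)))) b))
    D-+ʳ : ∀ u → D u (M i ⊕ M j) ≈ D u (M i) + D u (M j)
    D-+ʳ u = det-linear-row n j _ _ _ (E-offRow-j _ _ _) (E-offRow-j _ _ _)
      (λ b → reflexive (cong-app (≡.trans (E-j _ _) (≡.sym (≡.cong₂ (_⊕_) (E-j u (M i)) (E-j u (M j))))) b))
    E-M : ∀ a b → E (M i) (M j) a b ≈ M a b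
    E-M a b with a ≟ i | a ≟ j
    ... | yes ≡.refl | _          = reflexive (cong-app (E-i _ _) b)
    ... | no _       | yes ≡.refl = reflexive (cong-app (E-j _ _) b)
    ... | no a≢i     | no a≢j     = reflexive (cong-app (E-other _ _ a≢i a≢j) b)
    E-N : ∀ a b → E (M j) (M i) a b ≈ N a b
    E-N a b with a ≟ i | a ≟ j
    ... | yes ≡.refl | _          = trans (reflexive (cong-app (E-i _ _) b)) (Mj≈Ni b)
    ... | no _       | yes ≡.refl = trans (reflexive (cong-app (E-j _ _) b)) (Mi≈Nj b)
    ... | no a≢i     | no a≢j     = trans (reflexive (cong-app (E-other _ _ a≢i a≢j) b)) (others≈ a a≢i a≢j b)

  det-equalColumns : ∀ n (i j : Fin n) (M : Matrix R n) → i ≢ j → (∀ a → M a i ≈ M a j) → det R n M ≈ 0#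
  det-equalColumns n i j M i≢j coli≈colj = trans (sym (det-transpose n M)) (det-equalRows n i j (transpose M) i≢j coli≈colj)

  det-unitRow : ∀ n (r : Fin (suc n)) (M : Matrix R (suc n)) → (∀ b → M r b ≈ δ R r b) →
    det R (suc n) M ≈ det R n (minor R r r M)
  det-unitRow n r M Mr≈δr = begin
    det R (suc n) M                          ≈⟨ sym (trans (*-congʳ (sgn*sgn≈1 r)) (*-identityˡ _)) ⟩
    (sgn R r * sgn R r) * det R (suc n) M    ≈⟨ *-assoc _ _ _ ⟩
    sgn R r * (sgn R r * det R (suc n) M)    ≈⟨ *-congˡ (sym (det-toFront n r M)) ⟩
    sgn R r * Σ R (suc n) (laplaceTerm (M ∘ toFront r))
      ≈⟨ *-congˡ (trans (Σ-cong (suc n) (λ k → trans (x*yz≈y*xz (sgn R k) (M r k) (det R n (minor R r k M))) (*-congʳ (Mr≈δr k))))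
                        (Σ-δ (suc n) r (λ k → sgn R k * det R n (minor R r k M)))) ⟩
    sgn R r * (sgn R r * det R n (minor R r r M))  ≈⟨ sym (*-assoc _ _ _) ⟩
    (sgn R r * sgn R r) * det R n (minor R r r M)  ≈⟨ trans (*-congʳ (sgn*sgn≈1 r)) (*-identityˡ _) ⟩
    det R n (minor R r r M)                        ∎

  det-setRow-unit : ∀ n r (M : Matrix R (suc n)) → det R (suc n) (setRow M r (δ R r)) ≈ det R n (minor R r r M)
  det-setRow-unit n r M = trans (det-unitRow n r (setRow M r (δ R r)) (setRow-row M r (δ R r)))
    (det-cong n (λ a b → sym (setRow-offRow M r (δ R r) (punchIn r a) (punchInᵢ≢i r a) (punchIn r b))))

  -- Multiplicativity

  det-addMultiplesOfRow0 : ∀ n (M M′ : Matrix R (suc n)) (c : Fin n → Carrier) →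
    (∀ b → M′ zero b ≈ M zero b) → (∀ a b → M′ (suc a) b ≈ M (suc a) b + c a * M zero b) →
    det R (suc n) M′ ≈ det R (suc n) M
  det-addMultiplesOfRow0 zero    M M′ c row0≈ rows≈ = det-cong 1 {M′} {M} λ { zero b → row0≈ b }
  det-addMultiplesOfRow0 (suc n) M M′ c row0≈ rows≈ = begin
    det R N M′
      ≈⟨ det-linear-row N (suc zero) M′ M″ (setRow M′ (suc zero) (λ b → c zero * M zero b))
           (setRow-offRow M′ _ _) (setRow-offRow M′ _ _) (rows≈ zero) ⟩
    det R N M″ + det R N (setRow M′ (suc zero) (λ b → c zero * M zero b))
      ≈⟨ +-congˡ (det-scale-row N (suc zero) (c zero) (setRow M′ (suc zero) (λ b → c zero * M zero b)) (setRow M′ (suc zero) (M zero))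
           (λ a a≢1 b → trans (sym (setRow-offRow M′ (suc zero) (λ b → c zero * M zero b) a a≢1 b))
                              (setRow-offRow M′ (suc zero) (M zero) a a≢1 b))
           (λ b → refl)) ⟩
    det R N M″ + c zero * det R N (setRow M′ (suc zero) (M zero))
      ≈⟨ +-congˡ (trans (*-congˡ (det-equalRows01 n (setRow M′ (suc zero) (M zero)) row0≈)) (zeroʳ _)) ⟩
    det R N M″ + 0#                  ≈⟨ +-identityʳ _ ⟩
    det R N M″                       ≈⟨ x≈-y⇒y≈-x (det-swap01 n M″) ⟩
    - det R N (M″ ∘ swap01)
      ≈⟨ -‿cong (Σ-cong N λ k → *-congˡ {sgn R k} (*-congˡ {M (suc zero) k}
           (det-addMultiplesOfRow0 n (minor R zero k (M ∘ swap01)) (minor R zero k (M″ ∘ swap01)) (c ∘ suc)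
             (row0≈ ∘ punchIn k) (λ a → rows≈ (suc a) ∘ punchIn k)))) ⟩
    - det R N (M ∘ swap01)           ≈⟨ -‿cong (det-swap01 n M) ⟩
    - - det R N M                    ≈⟨ -‿involutive _ ⟩
    det R N M                        ∎
    where
    N = suc (suc n)
    M″ = setRow M′ (suc zero) (M (suc zero))

  matMul : ∀ n → Matrix R n → Matrix R n → Matrix R n
  matMul n A B a b = Σ R n (λ l → A a l * B l b)

  det-matMul : ∀ n (A B : Matrix R n) → det R n (matMul n A B) ≈ det R n A * det R n B
  det-matMul zero    A B = sym (*-identityˡ 1#)
  det-matMul (suc n) A B = begin
    det R N AB
      ≈⟨ Σ-cong N (λ c → trans (*-congˡ (*-distribʳ-Σ N (λ k → A zero k * B k c) (det R n (minor R zero c AB))))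
                        (trans (*-distribˡ-Σ N (sgn R c) (λ k → (A zero k * B k c) * det R n (minor R zero c AB)))
                               (Σ-cong N (λ k → shuffle (sgn R c) (A zero k) (B k c) (det R n (minor R zero c AB)))))) ⟩
    Σ R N (λ c → Σ R N (λ k → A zero k * laplaceTerm (rowByRow k) c))
      ≈⟨ Σ-comm N N (λ c k → A zero k * laplaceTerm (rowByRow k) c) ⟩
    Σ R N (λ k → Σ R N (λ c → A zero k * laplaceTerm (rowByRow k) c))
      ≈⟨ Σ-cong N (λ k → sym (*-distribˡ-Σ N (A zero k) (laplaceTerm (rowByRow k)))) ⟩
    Σ R N (λ k → A zero k * det R N (rowByRow k))
      ≈⟨ Σ-cong N (λ k → *-congˡ {A zero k}
           (trans (det-addMultiplesOfRow0 n (rowByRowᵏ k) (rowByRow k) (λ a → A (suc a) k) (λ b → refl) (split k))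
                                         (det-rowByRowᵏ k))) ⟩
    Σ R N (λ k → A zero k * (det R n (minor R zero k A) * (sgn R k * det R N B)))
      ≈⟨ Σ-cong N (λ k → regroup (A zero k) (det R n (minor R zero k A)) (sgn R k) (det R N B)) ⟩
    Σ R N (λ k → laplaceTerm A k * det R N B)
      ≈⟨ sym (*-distribʳ-Σ N (laplaceTerm A) (det R N B)) ⟩
    det R N A * det R N B ∎
    where
    N = suc n
    AB = matMul N A B
    shuffle : ∀ s a b d → s * ((a * b) * d) ≈ a * (s * (b * d))
    shuffle s a b d = trans (*-congˡ (*-assoc a b d)) (x*yz≈y*xz s a _)
    regroup : ∀ a x s d → a * (x * (s * d)) ≈ (s * (a * x)) * d
    regroup = solve 4 (λ a x s d → a :* (x :* (s :* d)) := (s :* (a :* x)) :* d) refl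
    -- Row 0 of AB is Σ_k A 0 k · (row k of B), so det AB = Σ_k A 0 k · det (rowByRow k).
    -- Dropping the k-th summand from the lower rows only subtracts multiples of row 0, and leaves
    -- lower rows that form (minor 0 k A)(B without row k), so the minors of rowByRowᵏ k factor by induction.
    rowByRow : Fin N → Matrix R N
    rowByRow k zero    = B k
    rowByRow k (suc a) = AB (suc a)
    rowByRowᵏ : Fin N → Matrix R N
    rowByRowᵏ k zero        = B k
    rowByRowᵏ k (suc a) b   = Σ R n (λ l → A (suc a) (punchIn k l) * B (punchIn k l) b)
    split : ∀ k a b → rowByRow k (suc a) b ≈ rowByRowᵏ k (suc a) b + A (suc a) k * B k b
    split k a b = trans (Σ-punchIn n k (λ l → A (suc a) l * B l b)) (+-comm _ _)
    det-rowByRowᵏ : ∀ k → det R N (rowByRowᵏ k) ≈ det R n (minor R zero k A) * (sgn R k * det R N B)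
    det-rowByRowᵏ k = begin
      det R N (rowByRowᵏ k)
        ≈⟨ Σ-cong N (λ c → *-congˡ {sgn R c} (*-congˡ {B k c} (det-matMul n (minor R zero k A) (minor R k c B)))) ⟩
      Σ R N (λ c → sgn R c * (B k c * (det R n (minor R zero k A) * det R n (minor R k c B))))
        ≈⟨ trans (Σ-cong N (λ c → trans (*-congˡ (x*yz≈y*xz (B k c) (det R n (minor R zero k A)) (det R n (minor R k c B))))
                                         (x*yz≈y*xz (sgn R c) (det R n (minor R zero k A)) _)))
                 (sym (*-distribˡ-Σ N (det R n (minor R zero k A)) (laplaceTerm (B ∘ toFront k)))) ⟩
      det R n (minor R zero k A) * det R N (B ∘ toFront k)   ≈⟨ *-congˡ (det-toFront n k B) ⟩
      det R n (minor R zero k A) * (sgn R k * det R N B)     ∎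

  det-diagonal : ∀ n (M : Matrix R n) (μ : Fin n → Carrier) → (∀ a b → M a b ≈ δ R a b * μ a) → det R n M ≈ Π R n μ
  det-diagonal zero    M μ M≈diag = refl
  det-diagonal (suc n) M μ M≈diag = begin
    laplaceTerm M zero + Σ R n (laplaceTerm M ∘ suc)
      ≈⟨ +-cong (*-congˡ (*-cong (trans (M≈diag zero zero) (trans (*-congʳ (δ-refl {suc n} zero)) (*-identityˡ _)))
                                 (det-diagonal n (minor R zero zero M) (μ ∘ suc) (λ a b → trans (M≈diag (suc a) (suc b)) (*-congʳ (δ-suc a b))))))
                (Σ-zero n _ off-diagonal) ⟩
    1# * (μ zero * Π R n (μ ∘ suc)) + 0# ≈⟨ trans (+-identityʳ _) (*-identityˡ _) ⟩
    Π R (suc n) μ ∎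
    where
    off-diagonal : ∀ k → laplaceTerm M (suc k) ≈ 0#
    off-diagonal k = trans (*-congˡ (*-congʳ (trans (M≈diag zero (suc k)) (trans (*-congʳ (δ-≢ {a = zero} {b = suc k} (λ ()))) (zeroˡ _)))))
                           (trans (*-congˡ (zeroˡ _)) (zeroʳ _))

  det-orthogonalConjugate : ∀ n (M Q : Matrix R n) (μ : Fin n → Carrier) →
    (∀ a b → matMul n (transpose Q) Q a b ≈ δ R a b) →
    (∀ a b → matMul n (matMul n (transpose Q) M) Q a b ≈ δ R a b * μ a) →
    det R n M ≈ Π R n μ
  det-orthogonalConjugate n M Q μ QᵀQ≈I QᵀMQ≈diag = begin
    det R n M                                  ≈⟨ sym (trans (*-congʳ det-QᵀQ≈1) (*-identityˡ _)) ⟩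
    det R n (matMul n Qᵀ Q) * det R n M        ≈⟨ *-congʳ (det-matMul n Qᵀ Q) ⟩
    (det R n Qᵀ * det R n Q) * det R n M       ≈⟨ xy*z≈xz*y _ _ _ ⟩
    (det R n Qᵀ * det R n M) * det R n Q       ≈⟨ *-congʳ (sym (det-matMul n Qᵀ M)) ⟩
    det R n (matMul n Qᵀ M) * det R n Q        ≈⟨ sym (det-matMul n (matMul n Qᵀ M) Q) ⟩
    det R n (matMul n (matMul n Qᵀ M) Q)       ≈⟨ det-diagonal n _ μ QᵀMQ≈diag ⟩
    Π R n μ                                    ∎
    where
    Qᵀ = transpose Q
    det-QᵀQ≈1 : det R n (matMul n Qᵀ Q) ≈ 1#
    det-QᵀQ≈1 = trans (det-diagonal n _ (λ _ → 1#) (λ a b → trans (QᵀQ≈I a b) (sym (*-identityʳ _)))) (Π-1 n)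

  eigenDecomposition-diagonalises : ∀ n (B Q : Matrix R n) (λs : Fin n → Carrier) → EigenDecomposition R n B Q λs →
    ∀ a b → matMul n (matMul n (transpose Q) B) Q a b ≈ δ R a b * λs a
  eigenDecomposition-diagonalises n B Q λs (QᵀQ≈I , B≈QΛQᵀ) a b = begin
    Σ R n (λ m → Σ R n (λ l → Q l a * B l m) * Q m b)  ≈⟨ Σ-cong n (λ m → trans (*-congʳ (QᵀB≈ΛQᵀ m)) (*-assoc _ _ _)) ⟩
    Σ R n (λ m → λs a * (Q m a * Q m b))              ≈⟨ sym (*-distribˡ-Σ n (λs a) (λ m → Q m a * Q m b)) ⟩
    λs a * Σ R n (λ m → Q m a * Q m b)                ≈⟨ trans (*-congˡ (QᵀQ≈I a b)) (*-comm _ _) ⟩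
    δ R a b * λs a                                    ∎
    where
    QᵀB≈ΛQᵀ : ∀ m → Σ R n (λ l → Q l a * B l m) ≈ λs a * Q m a
    QᵀB≈ΛQᵀ m = begin
      Σ R n (λ l → Q l a * B l m)
        ≈⟨ Σ-cong n (λ l → trans (*-congˡ (B≈QΛQᵀ l m)) (*-distribˡ-Σ n (Q l a) (λ k → Q l k * (λs k * Q m k)))) ⟩
      Σ R n (λ l → Σ R n (λ k → Q l a * (Q l k * (λs k * Q m k))))
        ≈⟨ Σ-comm n n (λ l k → Q l a * (Q l k * (λs k * Q m k))) ⟩
      Σ R n (λ k → Σ R n (λ l → Q l a * (Q l k * (λs k * Q m k))))
        ≈⟨ Σ-cong n (λ k → trans (Σ-cong n (λ l → sym (*-assoc (Q l a) (Q l k) _)))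
                                 (trans (sym (*-distribʳ-Σ n (λ l → Q l a * Q l k) (λs k * Q m k))) (*-congʳ (QᵀQ≈I a k)))) ⟩
      Σ R n (λ k → δ R a k * (λs k * Q m k))            ≈⟨ Σ-δ n a (λ k → λs k * Q m k) ⟩
      λs a * Q m a                                      ∎

  -- A repeated row

  module RepeatedRow {n : ℕ} (B : Matrix R (suc n)) (i j : Fin (suc n)) (i≢j : i ≢ j) (rowi≈rowj : ∀ b → B i b ≈ B j b) where

    j≢i : j ≢ i
    j≢i = i≢j ∘ ≡.sym

    principalMinor-other : ∀ r → r ≢ i → r ≢ j → det R n (minor R r r B) ≈ 0#
    principalMinor-other r r≢i r≢j = trans (sym (det-setRow-unit n r B)) (det-equalRows (suc n) i j (setRow B r (δ R r)) i≢j λ b →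
      trans (sym (setRow-offRow B r (δ R r) i (r≢i ∘ ≡.sym) b)) (trans (rowi≈rowj b) (setRow-offRow B r (δ R r) j (r≢j ∘ ≡.sym) b)))

    -- Swapping rows i and j of B with row i := eᵢ gives B with row j := eᵢ. Adding B with row j := eⱼ
    -- gives row j := eᵢ + eⱼ, whose columns i and j agree because B is symmetric.
    principalMinor-i≈j : Symmetric R B → det R n (minor R i i B) ≈ det R n (minor R j j B)
    principalMinor-i≈j B-sym = begin
      det R n (minor R i i B)    ≈⟨ sym (det-setRow-unit n i B) ⟩
      det R (suc n) Mᵢ
        ≈⟨ det-swapRows (suc n) i j Mᵢ N i≢j others≈ (λ b → trans (setRow-row B i _ b) (sym (setRow-row B j _ b))) Mᵢj≈Ni ⟩
      - det R (suc n) N          ≈⟨ sym (+-inverseʳ-unique _ _ N+Mⱼ≈0) ⟩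
      det R (suc n) Mⱼ           ≈⟨ det-setRow-unit n j B ⟩
      det R n (minor R j j B)    ∎
      where
      Mᵢ Mⱼ N W : Matrix R (suc n)
      Mᵢ = setRow B i (δ R i)
      Mⱼ = setRow B j (δ R j)
      N  = setRow B j (δ R i)
      W  = setRow B j (λ b → δ R i b + δ R j b)
      others≈ : ∀ a → a ≢ i → a ≢ j → ∀ b → Mᵢ a b ≈ N a b
      others≈ a a≢i a≢j b = trans (sym (setRow-offRow B i _ a a≢i b)) (setRow-offRow B j _ a a≢j b)
      Mᵢj≈Ni : ∀ b → Mᵢ j b ≈ N i b
      Mᵢj≈Ni b = trans (sym (setRow-offRow B i _ j j≢i b)) (trans (sym (rowi≈rowj b)) (setRow-offRow B j _ i i≢j b))
      W-columns : ∀ a → W a i ≈ W a j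
      W-columns a with a ≟ j
      ... | yes ≡.refl = trans (setRow-row B a _ i) (trans (+-cong (δ-refl i) (δ-≢ j≢i))
                           (trans (+-comm _ _) (sym (trans (setRow-row B a _ a) (+-cong (δ-≢ i≢j) (δ-refl a))))))
      ... | no a≢j     = trans (sym (setRow-offRow B j _ a a≢j i)) (trans (B-sym a i) (trans (rowi≈rowj a)
                           (trans (B-sym j a) (setRow-offRow B j _ a a≢j j))))
      N+Mⱼ≈0 : det R (suc n) N + det R (suc n) Mⱼ ≈ 0#
      N+Mⱼ≈0 = trans (sym (det-linear-row (suc n) j W N Mⱼ
                         (λ a a≢j b → trans (sym (setRow-offRow B j _ a a≢j b)) (setRow-offRow B j _ a a≢j b))
                         (λ a a≢j b → trans (sym (setRow-offRow B j _ a a≢j b)) (setRow-offRow B j _ a a≢j b))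
                         (λ b → trans (setRow-row B j _ b) (sym (+-cong (setRow-row B j _ b) (setRow-row B j _ b))))))
                     (det-equalColumns (suc n) i j W i≢j W-columns)

  Σ-principalMinors-repeatedRow : ∀ n (B : Matrix R (suc (suc n))) (i j : Fin (suc (suc n))) → i ≢ j → Symmetric R B →
    (∀ b → B i b ≈ B j b) →
    Σ R (suc (suc n)) (λ r → det R (suc n) (minor R r r B)) ≈ det R (suc n) (minor R j j B) + det R (suc n) (minor R j j B)
  Σ-principalMinors-repeatedRow n B i j i≢j B-sym rowi≈rowj = begin
    Σ R (suc (suc n)) P                                    ≈⟨ Σ-punchIn (suc n) j P ⟩
    P j + Σ R (suc n) (P ∘ punchIn j)                      ≈⟨ +-congˡ (Σ-punchIn n i′ (P ∘ punchIn j)) ⟩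
    P j + (P (punchIn j i′) + Σ R n (P ∘ punchIn j ∘ punchIn i′))
      ≈⟨ +-congˡ (+-cong (trans (reflexive (≡.cong P (punchIn-punchOut j≢i))) (principalMinor-i≈j B-sym)) (Σ-zero n _ rest≈0)) ⟩
    P j + (P j + 0#)                                       ≈⟨ +-congˡ (+-identityʳ _) ⟩
    P j + P j                                              ∎
    where
    open RepeatedRow B i j i≢j rowi≈rowj
    P : Fin (suc (suc n)) → Carrier
    P r = det R (suc n) (minor R r r B)
    i′ = punchOut j≢i
    rest≈0 : ∀ l → P (punchIn j (punchIn i′ l)) ≈ 0#
    rest≈0 l = principalMinor-other _
      (λ eq → punchInᵢ≢i i′ l (punchIn-injective j _ _ (≡.trans eq (≡.sym (punchIn-punchOut j≢i)))))
      (punchInᵢ≢i j _)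

module DualNumbers {c ℓ : Level} (R : CommutativeRing c ℓ) where
  open CommutativeRing R hiding (zero; isCommutativeRing)
  open NaturalSolver commutativeSemiring using (solve; _:+_; _:*_; _:=_; con)

  Dual : Set c
  Dual = Carrier × Carrier

  infix  4 _≈ε_
  infixl 6 _+ε_
  infixl 7 _*ε_

  _≈ε_ : Dual → Dual → Set ℓ
  (x , x′) ≈ε (y , y′) = (x ≈ y) × (x′ ≈ y′)

  _+ε_ _*ε_ : Dual → Dual → Dual
  (x , x′) +ε (y , y′) = (x + y , x′ + y′)
  (x , x′) *ε (y , y′) = (x * y , x * y′ + x′ * y)

  -ε_ : Dual → Dual
  -ε (x , x′) = (- x , - x′)

  0ε 1ε : Dual
  0ε = (0# , 0#)
  1ε = (1# , 0#)

  private
    *-assoc′ : ∀ a a′ b b′ c c′ → (a * b) * c′ + (a * b′ + a′ * b) * c ≈ a * (b * c′ + b′ * c) + a′ * (b * c)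
    *-assoc′ = solve 6 (λ a a′ b b′ c c′ →
      (a :* b) :* c′ :+ (a :* b′ :+ a′ :* b) :* c := a :* (b :* c′ :+ b′ :* c) :+ a′ :* (b :* c)) refl
    *-identityˡ′ : ∀ a a′ → 1# * a′ + 0# * a ≈ a′
    *-identityˡ′ = solve 2 (λ a a′ → con 1 :* a′ :+ con 0 :* a := a′) refl
    *-identityʳ′ : ∀ a a′ → a * 0# + a′ * 1# ≈ a′
    *-identityʳ′ = solve 2 (λ a a′ → a :* con 0 :+ a′ :* con 1 := a′) refl
    distribˡ′ : ∀ a a′ b b′ c c′ → a * (b′ + c′) + a′ * (b + c) ≈ (a * b′ + a′ * b) + (a * c′ + a′ * c)
    distribˡ′ = solve 6 (λ a a′ b b′ c c′ → a :* (b′ :+ c′) :+ a′ :* (b :+ c) := (a :* b′ :+ a′ :* b) :+ (a :* c′ :+ a′ :* c)) refl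
    distribʳ′ : ∀ a a′ b b′ c c′ → (b + c) * a′ + (b′ + c′) * a ≈ (b * a′ + b′ * a) + (c * a′ + c′ * a)
    distribʳ′ = solve 6 (λ a a′ b b′ c c′ → (b :+ c) :* a′ :+ (b′ :+ c′) :* a := (b :* a′ :+ b′ :* a) :+ (c :* a′ :+ c′ :* a)) refl
    *-comm′ : ∀ a a′ b b′ → a * b′ + a′ * b ≈ b * a′ + b′ * a
    *-comm′ = solve 4 (λ a a′ b b′ → a :* b′ :+ a′ :* b := b :* a′ :+ b′ :* a) refl

  isCommutativeRing : IsCommutativeRing _≈ε_ _+ε_ _*ε_ -ε_ 0ε 1ε
  isCommutativeRing = record
    { isRing = record
      { +-isAbelianGroup = record
        { isGroup = record
          { isMonoid = record
            { isSemigroup = record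
              { isMagma = record
                { isEquivalence = record
                  { refl  = refl , refl
                  ; sym   = λ (e , e′) → sym e , sym e′
                  ; trans = λ (e , e′) (f , f′) → trans e f , trans e′ f′
                  }
                ; ∙-cong = λ (e , e′) (f , f′) → +-cong e f , +-cong e′ f′
                }
              ; assoc = λ _ _ _ → +-assoc _ _ _ , +-assoc _ _ _
              }
            ; identity = (λ _ → +-identityˡ _ , +-identityˡ _) , (λ _ → +-identityʳ _ , +-identityʳ _)
            }
          ; inverse = (λ _ → -‿inverseˡ _ , -‿inverseˡ _) , (λ _ → -‿inverseʳ _ , -‿inverseʳ _)
          ; ⁻¹-cong = λ (e , e′) → -‿cong e , -‿cong e′
          }
        ; comm = λ _ _ → +-comm _ _ , +-comm _ _
        }
      ; *-cong     = λ (e , e′) (f , f′) → *-cong e f , +-cong (*-cong e f′) (*-cong e′ f)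
      ; *-assoc    = λ (a , a′) (b , b′) (c , c′) → *-assoc a b c , *-assoc′ a a′ b b′ c c′
      ; *-identity = (λ (a , a′) → *-identityˡ a , *-identityˡ′ a a′) , (λ (a , a′) → *-identityʳ a , *-identityʳ′ a a′)
      ; distrib    = (λ (a , a′) (b , b′) (c , c′) → distribˡ a b c , distribˡ′ a a′ b b′ c c′)
                   , (λ (a , a′) (b , b′) (c , c′) → distribʳ a b c , distribʳ′ a a′ b b′ c c′)
      }
    ; *-comm = λ (a , a′) (b , b′) → *-comm a b , *-comm′ a a′ b b′
    }

  dualNumbers : CommutativeRing c ℓ
  dualNumbers = record { isCommutativeRing = isCommutativeRing }

module DualDeterminant {c ℓ : Level} (R : CommutativeRing c ℓ) where
  open CommutativeRing R hiding (zero)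
  open RingProperties ring using (-0#≈0#)
  open Matrices R
  open DualNumbers R
  open SetoidReasoning setoid

  private
    Rε : CommutativeRing c ℓ
    Rε = dualNumbers
    module Mε = Matrices Rε
    module Rε = CommutativeRing Rε

  Σ-proj₁ : ∀ n (f : Fin n → Dual) → proj₁ (Σ Rε n f) ≈ Σ R n (proj₁ ∘ f)
  Σ-proj₁ zero    f = refl
  Σ-proj₁ (suc n) f = +-congˡ (Σ-proj₁ n (f ∘ suc))

  Σ-proj₂ : ∀ n (f : Fin n → Dual) → proj₂ (Σ Rε n f) ≈ Σ R n (proj₂ ∘ f)
  Σ-proj₂ zero    f = refl
  Σ-proj₂ (suc n) f = +-congˡ (Σ-proj₂ n (f ∘ suc))

  sgn-dual : ∀ {n} (k : Fin n) → sgn Rε k ≈ε (sgn R k , 0#)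
  sgn-dual zero    = refl , refl
  sgn-dual (suc k) = -‿cong (proj₁ (sgn-dual k)) , trans (-‿cong (proj₂ (sgn-dual k))) -0#≈0#

  δ-dual : ∀ {n} (a b : Fin n) → δ Rε a b ≈ε (δ R a b , 0#)
  δ-dual a b with a ≟ b
  ... | yes _ = refl , refl
  ... | no _  = refl , refl

  _+ε·_ : ∀ {n} → Matrix R n → Matrix R n → Matrix Rε n
  (X +ε· Y) a b = (X a b , Y a b)

  minor-setRow : ∀ {n} (X : Matrix R (suc n)) (r : Fin n) (v : Fin (suc n) → Carrier) k a b →
    setRow X (suc r) v (suc a) (punchIn k b) ≡ setRow (minor R zero k X) r (v ∘ punchIn k) a b
  minor-setRow X r v k a b = cong-app (map-updateAt-local {f = _∘ punchIn k} {g = const v} (X ∘ suc) r ≡.refl a) b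

  det-dual : ∀ n (X Y : Matrix R n) → det Rε n (X +ε· Y) ≈ε (det R n X , Σ R n (λ r → det R n (setRow X r (Y r))))
  det-dual zero    X Y = refl , refl
  det-dual (suc n) X Y = trans (proj₁ expand) (Σ-proj₁ (suc n) term) , trans (proj₂ expand) (trans (Σ-proj₂ (suc n) term) ε-part)
    where
    minorTerm : Fin (suc n) → Fin n → Carrier
    minorTerm k r = det R n (setRow (minor R zero k X) r (minor R zero k Y r))
    d p : Fin (suc n) → Carrier
    d k = det R n (minor R zero k X)
    p k = Σ R n (minorTerm k)
    term : Fin (suc n) → Dual
    term k = (sgn R k , 0#) *ε ((X zero k , Y zero k) *ε (d k , p k))
    expand : det Rε (suc n) (X +ε· Y) ≈ε Σ Rε (suc n) term
    expand = Mε.Σ-cong (suc n) λ k → Rε.*-cong (sgn-dual k)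
      (Rε.*-cong {X zero k , Y zero k} (refl , refl) (det-dual n (minor R zero k X) (minor R zero k Y)))
    lower-rows : Σ R (suc n) (λ k → sgn R k * (X zero k * p k)) ≈ Σ R n (λ r → det R (suc n) (setRow X (suc r) (Y (suc r))))
    lower-rows = begin
      Σ R (suc n) (λ k → sgn R k * (X zero k * p k))
        ≈⟨ Σ-cong (suc n) (λ k → trans (*-congˡ (*-distribˡ-Σ n (X zero k) (minorTerm k)))
                                       (*-distribˡ-Σ n (sgn R k) (λ r → X zero k * minorTerm k r))) ⟩
      Σ R (suc n) (λ k → Σ R n (λ r → sgn R k * (X zero k * minorTerm k r)))
        ≈⟨ Σ-comm (suc n) n (λ k r → sgn R k * (X zero k * minorTerm k r)) ⟩
      Σ R n (λ r → Σ R (suc n) (λ k → sgn R k * (X zero k * minorTerm k r)))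
        ≈⟨ Σ-cong n (λ r → Σ-cong (suc n) (λ k → *-congˡ {sgn R k} (*-congˡ {X zero k}
             (sym (det-cong n (λ a b → reflexive (minor-setRow X r (Y (suc r)) k a b))))))) ⟩
      Σ R n (λ r → det R (suc n) (setRow X (suc r) (Y (suc r)))) ∎
    ε-part : Σ R (suc n) (proj₂ ∘ term) ≈ Σ R (suc n) (λ r → det R (suc n) (setRow X r (Y r)))
    ε-part = begin
      Σ R (suc n) (proj₂ ∘ term)
        ≈⟨ Σ-cong (suc n) (λ k → trans (+-cong (distribˡ (sgn R k) (X zero k * p k) (Y zero k * d k)) (zeroˡ (X zero k * d k))) (+-identityʳ _)) ⟩
      Σ R (suc n) (λ k → sgn R k * (X zero k * p k) + sgn R k * (Y zero k * d k))
        ≈⟨ Σ-distrib-+ (suc n) (λ k → sgn R k * (X zero k * p k)) (λ k → sgn R k * (Y zero k * d k)) ⟩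
      Σ R (suc n) (λ k → sgn R k * (X zero k * p k)) + det R (suc n) (setRow X zero (Y zero))
        ≈⟨ trans (+-congʳ lower-rows) (+-comm _ _) ⟩
      Σ R (suc n) (λ r → det R (suc n) (setRow X r (Y r))) ∎

  Π-dual : ∀ n (λs : Fin (suc n) → Carrier) → Π Rε (suc n) (λ a → (λs a , 1#)) ≈ε (Π R (suc n) λs , det′ R n λs)
  Π-dual zero    λs = refl , trans (+-cong (zeroʳ _) (*-identityˡ _)) (+-comm _ _)
  Π-dual (suc n) λs = Rε.trans (Rε.*-cong (refl , refl) (Π-dual n (λs ∘ suc)))
    (refl , trans (+-cong (*-distribˡ-Σ (suc n) (λs zero) (λ j → Π R n (λs ∘ suc ∘ punchIn j))) (*-identityˡ _)) (+-comm _ _))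

  det-dual-eigen : ∀ n (B Q : Matrix R n) (λs : Fin n → Carrier) → EigenDecomposition R n B Q λs →
    det Rε n (B +ε· δ R) ≈ε Π Rε n (λ a → (λs a , 1#))
  det-dual-eigen n B Q λs eig@(QᵀQ≈I , _) = Mε.det-orthogonalConjugate n (B +ε· δ R) Q̂ μ Q̂ᵀQ̂≈I Q̂ᵀB̂Q̂≈diag
    where
    Q̂ B̂ Q̂ᵀB̂ : Matrix Rε n
    Q̂ = Q +ε· (λ _ _ → 0#)
    B̂ = B +ε· δ R
    Q̂ᵀB̂ = Mε.matMul n (Mε.transpose Q̂) B̂
    μ : Fin n → Dual
    μ a = (λs a , 1#)
    δ-dual-proj₁ : ∀ a b x → proj₁ (δ Rε a b *ε x) ≈ δ R a b * proj₁ x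
    δ-dual-proj₁ a b x = *-congʳ (proj₁ (δ-dual a b))
    δ-dual-proj₂ : ∀ a b x → proj₂ (δ Rε a b *ε x) ≈ δ R a b * proj₂ x
    δ-dual-proj₂ a b x = trans (+-cong (*-congʳ (proj₁ (δ-dual a b))) (trans (*-congʳ (proj₂ (δ-dual a b))) (zeroˡ _))) (+-identityʳ _)
    Q̂ᵀQ̂≈I : ∀ a b → Mε.matMul n (Mε.transpose Q̂) Q̂ a b ≈ε δ Rε a b
    Q̂ᵀQ̂≈I a b =
      trans (Σ-proj₁ n _) (trans (QᵀQ≈I a b) (sym (proj₁ (δ-dual a b)))) ,
      trans (Σ-proj₂ n _) (trans (Σ-zero n _ (λ l → trans (+-cong (zeroʳ _) (zeroˡ _)) (+-identityʳ 0#))) (sym (proj₂ (δ-dual a b))))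
    Q̂ᵀB̂-proj₁ : ∀ a m → proj₁ (Q̂ᵀB̂ a m) ≈ Σ R n (λ l → Q l a * B l m)
    Q̂ᵀB̂-proj₁ a m = Σ-proj₁ n _
    Q̂ᵀB̂-proj₂ : ∀ a m → proj₂ (Q̂ᵀB̂ a m) ≈ Q m a
    Q̂ᵀB̂-proj₂ a m = trans (Σ-proj₂ n _)
      (trans (Σ-cong n (λ l → trans (+-congˡ (zeroˡ (B l m))) (+-identityʳ _))) (Σ-δʳ n m (λ l → Q l a)))
    Q̂ᵀB̂Q̂≈diag : ∀ a b → Mε.matMul n Q̂ᵀB̂ Q̂ a b ≈ε (δ Rε a b *ε μ a)
    Q̂ᵀB̂Q̂≈diag a b =
      (begin
        proj₁ (Mε.matMul n Q̂ᵀB̂ Q̂ a b)                      ≈⟨ Σ-proj₁ n _ ⟩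
        Σ R n (λ m → proj₁ (Q̂ᵀB̂ a m) * Q m b)              ≈⟨ Σ-cong n (λ m → *-congʳ (Q̂ᵀB̂-proj₁ a m)) ⟩
        matMul n (matMul n (transpose Q) B) Q a b          ≈⟨ eigenDecomposition-diagonalises n B Q λs eig a b ⟩
        δ R a b * λs a                                     ≈⟨ sym (δ-dual-proj₁ a b (μ a)) ⟩
        proj₁ (δ Rε a b *ε μ a)                            ∎) ,
      (begin
        proj₂ (Mε.matMul n Q̂ᵀB̂ Q̂ a b)                      ≈⟨ Σ-proj₂ n _ ⟩
        Σ R n (λ m → proj₁ (Q̂ᵀB̂ a m) * 0# + proj₂ (Q̂ᵀB̂ a m) * Q m b)
          ≈⟨ Σ-cong n (λ m → trans (+-cong (zeroʳ _) (*-congʳ (Q̂ᵀB̂-proj₂ a m))) (+-identityˡ _)) ⟩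
        Σ R n (λ m → Q m a * Q m b)                        ≈⟨ QᵀQ≈I a b ⟩
        δ R a b                                            ≈⟨ sym (trans (δ-dual-proj₂ a b (μ a)) (*-identityʳ _)) ⟩
        proj₂ (δ Rε a b *ε μ a)                            ∎)

  det′-eigenvalues : ∀ n (B Q : Matrix R (suc n)) (λs : Fin (suc n) → Carrier) → EigenDecomposition R (suc n) B Q λs →
    det′ R n λs ≈ Σ R (suc n) (λ r → det R n (minor R r r B))
  det′-eigenvalues n B Q λs eig = begin
    det′ R n λs                                                  ≈⟨ sym (proj₂ (Π-dual n λs)) ⟩
    proj₂ (Π Rε (suc n) (λ a → (λs a , 1#)))                     ≈⟨ sym (proj₂ (det-dual-eigen (suc n) B Q λs eig)) ⟩
    proj₂ (det Rε (suc n) (B +ε· δ R))                           ≈⟨ proj₂ (det-dual (suc n) B (δ R)) ⟩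
    Σ R (suc n) (λ r → det R (suc n) (setRow B r (δ R r)))       ≈⟨ Σ-cong (suc n) (λ r → det-setRow-unit n r B) ⟩
    Σ R (suc n) (λ r → det R n (minor R r r B))                  ∎

open Matrices using (det-equalRows; Σ-principalMinors-repeatedRow)
open DualDeterminant using (det′-eigenvalues)

lemma2p4 : {c ℓ : Level} (R : CommutativeRing c ℓ) (n : ℕ)
    (B : Matrix R (suc (suc n))) (i j : Fin (suc (suc n))) →
    Symmetric R B → i ≢ j →
    (∀ k → CommutativeRing._≈_ R (B i k) (B j k)) →
    CommutativeRing._≈_ R (det R (suc (suc n)) B) (CommutativeRing.0# R)
    × ((Q : Matrix R (suc (suc n))) (λs : Fin (suc (suc n)) → CommutativeRing.Carrier R) →
       EigenDecomposition R (suc (suc n)) B Q λs →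
       CommutativeRing._≈_ R (det′ R (suc n) λs)
         (CommutativeRing._+_ R (det R (suc n) (minor R j j B)) (det R (suc n) (minor R j j B))))
lemma2p4 R n B i j B-sym i≢j rowi≈rowj =
  det-equalRows R (suc (suc n)) i j B i≢j rowi≈rowj ,
  λ Q λs eig → CommutativeRing.trans R (det′-eigenvalues R (suc n) B Q λs eig)
                                       (Σ-principalMinors-repeatedRow R n B i j i≢j B-sym rowi≈rowj)
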